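{- Let $n\ge 2$ and let $C_n$ be the cycle on $n$ vertices, where $C_2$ is taken to be $K_2$. Then the independence number of the 2-supertoken graph of $C_n$ is $$\alpha(\mathcal F_2(C_n))=\begin{cases} r(n+2) & \text{if } n=4r \text{ or } n=4r+1,\\ (r+1)n & \text{if } n=4r+2 \text{ or } n=4r+3.\end{cases}$$
   Context: For a finite simple graph $G$ and integer $k\ge 1$, the $k$-supertoken graph $\mathcal F_k(G)$ has as vertices all multisets of size $k$ of elements of $V(G)$; two multisets $A,B$ are adjacent iff $A=S\uplus\{u\}$, $B=S\uplus\{v\}$ for some multiset $S$ of size $k-1$ and some edge $uv\in E(G)$. Thus $\mathcal F_2(C_n)$ has vertices the multisets $\{i,j\}$ ($i,j\in\mathbb Z_n$, possibly $i=j$), and $\{i,j\}\sim\{i,j'\}$ iff $jj'$ is an edge of $C_n$. $\alpha$ denotes the independence number. -}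

module Defs where

open import Data.Nat using (ℕ; zero; suc; _+_; _*_; _≤_)
open import Data.Fin using (Fin; toℕ)
import Data.Fin as F
open import Data.Product using (Σ; ∃; _×_; _,_)
open import Data.Sum using (_⊎_)
open import Data.List using (List; length)
open import Data.List.Relation.Unary.All using (All)
open import Data.List.Relation.Unary.Unique.Propositional using (Unique)
open import Data.List.Membership.Propositional using (_∈_)
open import Relation.Binary.PropositionalEquality using (_≡_; _≢_)
open import Relation.Nullary using (¬_)

CycSucc : {n : ℕ} → Fin n → Fin n → Set
CycSucc {n} i j = (toℕ j ≡ suc (toℕ i)) ⊎ ((suc (toℕ i) ≡ n) × (toℕ j ≡ 0))

-- Edge relation of the cycle C_n (simple graph: no loops).
-- For n = 2 this gives the single edge 01, i.e. C_2 = K_2.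
CycleAdj : (n : ℕ) → Fin n → Fin n → Set
CycleAdj n i j = (i ≢ j) × (CycSucc i j ⊎ CycSucc j i)

-- Multisets of size 2 over a vertex type V are represented by ordered pairs;
-- equality of the underlying multisets:
MSetEq₂ : {V : Set} → V × V → V × V → Set
MSetEq₂ (a , b) (c , d) = ((a ≡ c) × (b ≡ d)) ⊎ ((a ≡ d) × (b ≡ c))

F2Adj : {V : Set} → (V → V → Set) → V × V → V × V → Set
F2Adj {V} E A B = Σ V λ s → Σ V λ u → Σ V λ v →
  MSetEq₂ A (s , u) × MSetEq₂ B (s , v) × E u v

-- Vertices of F_2(C_n): multisets {a,b} of Fin n, canonically represented by
-- pairs (a , b) with a ≤ b.
F2Vertex : (n : ℕ) → Fin n × Fin n → Set
F2Vertex n (a , b) = a F.≤ b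

IndepF2 : (n : ℕ) → List (Fin n × Fin n) → Set
IndepF2 n L = All (F2Vertex n) L × Unique L ×
  (∀ {A B} → A ∈ L → B ∈ L → ¬ F2Adj (CycleAdj n) A B)

IndependenceNumberF2C : (n k : ℕ) → Set
IndependenceNumberF2C n k =
  (Σ (List (Fin n × Fin n)) λ L → IndepF2 n L × (length L ≡ k)) ×
  (∀ L → IndepF2 n L → length L ≤ k)

-- Upper bound: count every vertex {x ≤ y} of an independent set twice, once from each of its
-- tokens c, by the code (c , ⌊d/2⌋), where d ∈ {0,…,n} is the clockwise distance from c to the
-- other token. Two vertices through c whose distances differ by one are joined by moving the other
-- token, so the codes of an independent set are pairwise distinct; if n ≤ 2h+1 there are only
-- n(h+1) codes, hence 2α ≤ n(h+1).
-- Lower bound: vertex {x , y} lies in class s = n − |x − y|, and class s has s vertices. An edge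
-- only joins classes s and s ± 1, or s and n + 1 − s, so the union of the classes in a set S with
-- no two consecutive members and no two summing to n + 1 is independent. The sets
-- {2, 4, …, n} for even n and {2, 4, …, 2r} ∪ {2r+3, 2r+5, …, n} for n = 2(r+t)+1, t ∈ {r, r+1},
-- attain the upper bound.
module Submission where

open import Defs
open import Data.Nat.Base using (ℕ; zero; suc; _+_; _*_; _∸_; _≤_; _<_; s≤s; s≤s⁻¹; ⌊_/2⌋; ∣_-_∣)
open import Data.Nat.Properties
open import Data.Nat.ListAction using (sum)
open import Data.Nat.ListAction.Properties using (sum-++)
open import Data.Nat.Tactic.RingSolver using (solve-∀)
open import Data.Fin.Base as Fin using (Fin; toℕ; fromℕ<; combine)
open import Data.Fin.Properties using (toℕ<n; toℕ-injective; toℕ-fromℕ<; fromℕ<-injective; combine-injective; pigeonhole)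
import Data.Fin.Properties as Finₚ
open import Data.List.Base using (List; []; _∷_; length; map; _++_; lookup; allFin)
open import Data.List.Properties using (length-map; length-++; length-tabulate)
open import Data.List.Relation.Unary.All as All using (All; []; _∷_)
open import Data.List.Relation.Unary.AllPairs using ([]; _∷_)
open import Data.List.Relation.Unary.Unique.Propositional using (Unique)
import Data.List.Relation.Unary.Unique.Propositional.Properties as Unique
open import Data.List.Membership.Propositional using (_∈_)
open import Data.List.Membership.Propositional.Properties using (∈-lookup; ∈-map⁻; ∈-++⁻)
open import Data.List.Relation.Unary.Any using (here; there)
open import Data.Product using (Σ; ∃-syntax; _×_; _,_; proj₁; proj₂; uncurry)
open import Data.Sum as Sum using (_⊎_; inj₁; inj₂)
open import Data.Empty using (⊥; ⊥-elim)
open import Relation.Nullary using (¬_; yes; no)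
open import Relation.Binary.PropositionalEquality

private
  variable
    A B : Set

Unique-lookup-injective : ∀ {xs : List A} → Unique xs →
  ∀ {i j} → lookup xs i ≡ lookup xs j → i ≡ j
Unique-lookup-injective (x∉xs ∷ u) {Fin.zero}  {Fin.zero}  _ = refl
Unique-lookup-injective (x∉xs ∷ u) {Fin.zero}  {Fin.suc j} e = ⊥-elim (All.lookup x∉xs (∈-lookup j) e)
Unique-lookup-injective (x∉xs ∷ u) {Fin.suc i} {Fin.zero}  e = ⊥-elim (All.lookup x∉xs (∈-lookup i) (sym e))
Unique-lookup-injective (x∉xs ∷ u) {Fin.suc i} {Fin.suc j} e = cong Fin.suc (Unique-lookup-injective u e)

Unique⇒length≤ : ∀ {m} {xs : List (Fin m)} → Unique xs → length xs ≤ m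
Unique⇒length≤ {m} {xs} u with length xs ≤? m
... | yes ≤m = ≤m
... | no ≰m with pigeonhole (≰⇒> ≰m) (lookup xs)
...   | i , j , i<j , eq = ⊥-elim (Finₚ.<⇒≢ i<j (Unique-lookup-injective u eq))

Unique⇒length≤* : ∀ {m k} {xs : List (Fin m × Fin k)} → Unique xs → length xs ≤ m * k
Unique⇒length≤* {m} {k} {xs} u = begin
  length xs                         ≡⟨ length-map (uncurry combine) xs ⟨
  length (map (uncurry combine) xs) ≤⟨ Unique⇒length≤ (Unique.map⁺ combine-injective′ u) ⟩
  m * k                             ∎
  where
  open ≤-Reasoning
  combine-injective′ : ∀ {p q} → uncurry combine p ≡ uncurry combine q → p ≡ q
  combine-injective′ {i , j} {k , l} eq with combine-injective i j k l eq
  ... | refl , refl = refl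

map⁺-injectiveOn : ∀ {f : A → B} {xs : List A} →
  (∀ {x y} → x ∈ xs → y ∈ xs → f x ≡ f y → x ≡ y) → Unique xs → Unique (map f xs)
map⁺-injectiveOn {xs = []} inj [] = []
map⁺-injectiveOn {f = f} {xs = x ∷ xs} inj (x∉xs ∷ u) =
  All.tabulate fx∉ ∷ map⁺-injectiveOn (λ p q → inj (there p) (there q)) u
  where
  fx∉ : ∀ {z} → z ∈ map f xs → f x ≢ z
  fx∉ z∈ fx≡z with ∈-map⁻ f z∈
  ... | y , y∈ , refl = All.lookup x∉xs y∈ (inj (here refl) (there y∈) fx≡z)

⌊m/2⌋≡⌊n/2⌋⇒m≡n⊎n≡1+m⊎m≡1+n : ∀ m n → ⌊ m /2⌋ ≡ ⌊ n /2⌋ → m ≡ n ⊎ n ≡ suc m ⊎ m ≡ suc n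
⌊m/2⌋≡⌊n/2⌋⇒m≡n⊎n≡1+m⊎m≡1+n 0 0 _ = inj₁ refl
⌊m/2⌋≡⌊n/2⌋⇒m≡n⊎n≡1+m⊎m≡1+n 0 1 _ = inj₂ (inj₁ refl)
⌊m/2⌋≡⌊n/2⌋⇒m≡n⊎n≡1+m⊎m≡1+n 1 0 _ = inj₂ (inj₂ refl)
⌊m/2⌋≡⌊n/2⌋⇒m≡n⊎n≡1+m⊎m≡1+n 1 1 _ = inj₁ refl
⌊m/2⌋≡⌊n/2⌋⇒m≡n⊎n≡1+m⊎m≡1+n (suc (suc m)) (suc (suc n)) eq
  with ⌊m/2⌋≡⌊n/2⌋⇒m≡n⊎n≡1+m⊎m≡1+n m n (suc-injective eq)
... | inj₁ refl        = inj₁ refl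
... | inj₂ (inj₁ refl) = inj₂ (inj₁ refl)
... | inj₂ (inj₂ refl) = inj₂ (inj₂ refl)

m≤1+h+h⇒⌊m/2⌋≤h : ∀ {m} h → m ≤ suc (h + h) → ⌊ m /2⌋ ≤ h
m≤1+h+h⇒⌊m/2⌋≤h {m} h le = subst (⌊ m /2⌋ ≤_) (sym (n≡⌈n+n/2⌉ h)) (⌊n/2⌋-mono le)

m+m≤1+k+k⇒m≤k : ∀ {m} k → m + m ≤ suc (k + k) → m ≤ k
m+m≤1+k+k⇒m≤k {m} k le = subst₂ _≤_ (sym (n≡⌊n+n/2⌋ m)) (sym (n≡⌈n+n/2⌉ k)) (⌊n/2⌋-mono le)

2*m≡m+m : ∀ m → 2 * m ≡ m + m
2*m≡m+m m = cong (m +_) (+-identityʳ m)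

module _ {n : ℕ} where

  -- u lies d steps clockwise from c; the second case is a walk through n − 1 → 0, such as d = n from c to c.
  Gap : Fin n → ℕ → Fin n → Set
  Gap c d u = toℕ c + d ≡ toℕ u ⊎ toℕ c + d ≡ toℕ u + n

  CycSucc-irreflexive : 2 ≤ n → ∀ {u : Fin n} → ¬ CycSucc u u
  CycSucc-irreflexive 2≤n (inj₁ u≡1+u)           = 1+n≢n (sym u≡1+u)
  CycSucc-irreflexive 2≤n {u} (inj₂ (1+u≡n , u≡0)) with subst (2 ≤_) (trans (sym 1+u≡n) (cong suc u≡0)) 2≤n
  ... | s≤s ()

  Gap-suc⇒CycSucc : ∀ {c u v d} → Gap c d u → Gap c (suc d) v → CycSucc u v
  Gap-suc⇒CycSucc {c} {u} {v} {d} (inj₁ eu) (inj₁ ev) = inj₁ (begin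
    toℕ v            ≡⟨ ev ⟨
    toℕ c + suc d    ≡⟨ +-suc (toℕ c) d ⟩
    suc (toℕ c + d)  ≡⟨ cong suc eu ⟩
    suc (toℕ u)      ∎)
    where open ≡-Reasoning
  Gap-suc⇒CycSucc {c} {u} {v} {d} (inj₁ eu) (inj₂ ev) = inj₂ (1+u≡n , v≡0)
    where
    1+u≡v+n : suc (toℕ u) ≡ toℕ v + n
    1+u≡v+n = trans (cong suc (sym eu)) (trans (sym (+-suc (toℕ c) d)) ev)
    v+n≤n : toℕ v + n ≤ 0 + n
    v+n≤n = subst (_≤ n) 1+u≡v+n (toℕ<n u)
    v≡0 : toℕ v ≡ 0
    v≡0 = n≤0⇒n≡0 (+-cancelʳ-≤ n (toℕ v) 0 v+n≤n)
    1+u≡n : suc (toℕ u) ≡ n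
    1+u≡n = trans 1+u≡v+n (cong (_+ n) v≡0)
  Gap-suc⇒CycSucc {c} {u} {v} {d} (inj₂ eu) (inj₁ ev) = ⊥-elim (<⇒≱ (toℕ<n v) n≤v)
    where
    n≤v : n ≤ toℕ v
    n≤v = subst (n ≤_) (trans (trans (cong suc (sym eu)) (sym (+-suc (toℕ c) d))) ev)
            (≤-trans (m≤n+m n (toℕ u)) (n≤1+n _))
  Gap-suc⇒CycSucc {c} {d = d} (inj₂ eu) (inj₂ ev) =
    inj₁ (+-cancelʳ-≡ n _ _ (trans (sym ev) (trans (+-suc (toℕ c) d) (cong suc eu))))

  Gap-suc⇒CycleAdj : 2 ≤ n → ∀ {c u v d} → Gap c d u → Gap c (suc d) v → CycleAdj n u v
  Gap-suc⇒CycleAdj 2≤n gu gv =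
    (λ { refl → CycSucc-irreflexive 2≤n u→v }) , inj₁ u→v
    where u→v = Gap-suc⇒CycSucc gu gv

module UpperBound {n h : ℕ} (2≤n : 2 ≤ n) (n≤1+h+h : n ≤ suc (h + h)) where

  gap₁ gap₂ : Fin n × Fin n → ℕ
  gap₁ (x , y) = toℕ y ∸ toℕ x
  gap₂ p       = n ∸ gap₁ p

  gap₁≤n : ∀ p → gap₁ p ≤ n
  gap₁≤n (x , y) = ≤-trans (m∸n≤m (toℕ y) (toℕ x)) (<⇒≤ (toℕ<n y))

  gap₁-Gap : ∀ {x y : Fin n} → x Fin.≤ y → toℕ x + gap₁ (x , y) ≡ toℕ y
  gap₁-Gap x≤y = m+[n∸m]≡n x≤y

  gap₂-Gap : ∀ {x y : Fin n} → x Fin.≤ y → toℕ y + gap₂ (x , y) ≡ toℕ x + n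
  gap₂-Gap {x} {y} x≤y = begin
    toℕ y + (n ∸ e)            ≡⟨ cong (_+ (n ∸ e)) (gap₁-Gap x≤y) ⟨
    toℕ x + e + (n ∸ e)        ≡⟨ +-assoc (toℕ x) e (n ∸ e) ⟩
    toℕ x + (e + (n ∸ e))      ≡⟨ cong (toℕ x +_) (m+[n∸m]≡n (gap₁≤n (x , y))) ⟩
    toℕ x + n                  ∎
    where
    open ≡-Reasoning
    e = gap₁ (x , y)

  code : Fin n → (d : ℕ) → d ≤ n → Fin n × Fin (suc h)
  code c d d≤n = c , fromℕ< (s≤s (m≤1+h+h⇒⌊m/2⌋≤h h (≤-trans d≤n n≤1+h+h)))

  code-injective : ∀ {c c' d d'} (p : d ≤ n) (p' : d' ≤ n) →
    code c d p ≡ code c' d' p' → c ≡ c' × ⌊ d /2⌋ ≡ ⌊ d' /2⌋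
  code-injective {d = d} {d'} p p' eq =
    cong proj₁ eq , fromℕ<-injective ⌊ d /2⌋ ⌊ d' /2⌋ _ _ (cong proj₂ eq)

  code₁ code₂ : Fin n × Fin n → Fin n × Fin (suc h)
  code₁ p = code (proj₁ p) (gap₁ p) (gap₁≤n p)
  code₂ p = code (proj₂ p) (gap₂ p) (m∸n≤m n (gap₁ p))

  module _ {L : List (Fin n × Fin n)} (L-indep : IndepF2 n L) where

    private
      sorted : ∀ {p} → p ∈ L → F2Vertex n p
      sorted = All.lookup (proj₁ L-indep)

      independent : ∀ {p q} → p ∈ L → q ∈ L → ¬ F2Adj (CycleAdj n) p q
      independent = proj₂ (proj₂ L-indep)

    -- If the gaps differed by one, moving the free token one step would join the two vertices.
    same-half⇒same-gap : ∀ {p q c u v d d'} → p ∈ L → q ∈ L →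
      MSetEq₂ p (c , u) → MSetEq₂ q (c , v) → Gap c d u → Gap c d' v →
      ⌊ d /2⌋ ≡ ⌊ d' /2⌋ → d ≡ d'
    same-half⇒same-gap {c = c} {u} {v} {d} {d'} p∈ q∈ p≈ q≈ gu gv halves
      with ⌊m/2⌋≡⌊n/2⌋⇒m≡n⊎n≡1+m⊎m≡1+n d d' halves
    ... | inj₁ d≡d'        = d≡d'
    ... | inj₂ (inj₁ refl) = ⊥-elim (independent p∈ q∈ (c , u , v , p≈ , q≈ , Gap-suc⇒CycleAdj 2≤n gu gv))
    ... | inj₂ (inj₂ refl) = ⊥-elim (independent q∈ p∈ (c , v , u , q≈ , p≈ , Gap-suc⇒CycleAdj 2≤n gv gu))

    code₁-injectiveOn : ∀ {p q} → p ∈ L → q ∈ L → code₁ p ≡ code₁ q → p ≡ q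
    code₁-injectiveOn {x , y} {x' , y'} p∈ q∈ eq
      with code-injective (gap₁≤n (x , y)) (gap₁≤n (x' , y')) eq
    ... | refl , halves = cong (x ,_) (toℕ-injective (begin
      toℕ y                 ≡⟨ gap₁-Gap (sorted p∈) ⟨
      toℕ x + gap₁ (x , y)  ≡⟨ cong (toℕ x +_) gaps ⟩
      toℕ x + gap₁ (x , y') ≡⟨ gap₁-Gap (sorted q∈) ⟩
      toℕ y'                ∎))
      where
      open ≡-Reasoning
      gaps = same-half⇒same-gap p∈ q∈ (inj₁ (refl , refl)) (inj₁ (refl , refl))
               (inj₁ (gap₁-Gap (sorted p∈))) (inj₁ (gap₁-Gap (sorted q∈))) halves

    code₂-injectiveOn : ∀ {p q} → p ∈ L → q ∈ L → code₂ p ≡ code₂ q → p ≡ q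
    code₂-injectiveOn {x , y} {x' , y'} p∈ q∈ eq
      with code-injective (m∸n≤m n (gap₁ (x , y))) (m∸n≤m n (gap₁ (x' , y'))) eq
    ... | refl , halves = cong (_, y) (toℕ-injective (+-cancelʳ-≡ n _ _ (begin
      toℕ x + n              ≡⟨ gap₂-Gap (sorted p∈) ⟨
      toℕ y + gap₂ (x , y)   ≡⟨ cong (toℕ y +_) gaps ⟩
      toℕ y + gap₂ (x' , y)  ≡⟨ gap₂-Gap (sorted q∈) ⟩
      toℕ x' + n             ∎)))
      where
      open ≡-Reasoning
      gaps = same-half⇒same-gap p∈ q∈ (inj₂ (refl , refl)) (inj₂ (refl , refl))
               (inj₂ (gap₂-Gap (sorted p∈))) (inj₂ (gap₂-Gap (sorted q∈))) halves

    code₁≢code₂ : ∀ {p q} → p ∈ L → q ∈ L → code₁ p ≢ code₂ q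
    code₁≢code₂ {x , y} {x' , y'} p∈ q∈ eq
      with code-injective (gap₁≤n (x , y)) (m∸n≤m n (gap₁ (x' , y'))) eq
    ... | refl , halves = <⇒≱ (toℕ<n y) (begin
      n                      ≤⟨ m≤n+m n (toℕ x') ⟩
      toℕ x' + n             ≡⟨ gap₂-Gap (sorted q∈) ⟨
      toℕ x + gap₂ (x' , x)  ≡⟨ cong (toℕ x +_) gaps ⟨
      toℕ x + gap₁ (x , y)   ≡⟨ gap₁-Gap (sorted p∈) ⟩
      toℕ y                  ∎)
      where
      open ≤-Reasoning
      gaps = same-half⇒same-gap p∈ q∈ (inj₁ (refl , refl)) (inj₂ (refl , refl))
               (inj₁ (gap₁-Gap (sorted p∈))) (inj₂ (gap₂-Gap (sorted q∈))) halves

    codes-unique : Unique (map code₁ L ++ map code₂ L)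
    codes-unique = Unique.++⁺
      (map⁺-injectiveOn code₁-injectiveOn (proj₁ (proj₂ L-indep)))
      (map⁺-injectiveOn code₂-injectiveOn (proj₁ (proj₂ L-indep)))
      disjoint
      where
      disjoint : ∀ {c} → ¬ (c ∈ map code₁ L × c ∈ map code₂ L)
      disjoint (c∈₁ , c∈₂) with ∈-map⁻ code₁ c∈₁ | ∈-map⁻ code₂ c∈₂
      ... | p , p∈ , refl | q , q∈ , eq = code₁≢code₂ p∈ q∈ eq

    upperBound : length L + length L ≤ n * suc h
    upperBound = begin
      length L + length L                      ≡⟨ cong₂ _+_ (length-map code₁ L) (length-map code₂ L) ⟨
      length (map code₁ L) + length (map code₂ L) ≡⟨ length-++ (map code₁ L) ⟨
      length (map code₁ L ++ map code₂ L)      ≤⟨ Unique⇒length≤* codes-unique ⟩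
      n * suc h                                ∎
      where open ≤-Reasoning

∣m-1+n∣≡1+∣m-n∣⊎∣m-n∣≡1+∣m-1+n∣ : ∀ m n → ∣ m - suc n ∣ ≡ suc ∣ m - n ∣ ⊎ ∣ m - n ∣ ≡ suc ∣ m - suc n ∣
∣m-1+n∣≡1+∣m-n∣⊎∣m-n∣≡1+∣m-1+n∣ zero    n       = inj₁ refl
∣m-1+n∣≡1+∣m-n∣⊎∣m-n∣≡1+∣m-1+n∣ (suc m) zero    = inj₂ (cong suc (sym (∣-∣-identityʳ m)))
∣m-1+n∣≡1+∣m-n∣⊎∣m-n∣≡1+∣m-1+n∣ (suc m) (suc n) = ∣m-1+n∣≡1+∣m-n∣⊎∣m-n∣≡1+∣m-1+n∣ m n

module _ (n : ℕ) where

  Class : ℕ → Fin n × Fin n → Set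
  Class s (x , y) = ∣ toℕ x - toℕ y ∣ + s ≡ n

  Clash : ℕ → ℕ → Set
  Clash s s' = s' ≡ suc s ⊎ s ≡ suc s' ⊎ s + s' ≡ suc n

  record Admissible (S : List ℕ) : Set where
    field
      unique        : Unique S
      bounded       : All (_≤ n) S
      no-successor  : ∀ {s s'} → s ∈ S → s' ∈ S → s' ≢ suc s
      no-complement : ∀ {s s'} → s ∈ S → s' ∈ S → s + s' ≢ suc n

    clash-free : ∀ {s s'} → s ∈ S → s' ∈ S → ¬ Clash s s'
    clash-free s∈ s'∈ (inj₁ e)        = no-successor s∈ s'∈ e
    clash-free s∈ s'∈ (inj₂ (inj₁ e)) = no-successor s'∈ s∈ e
    clash-free s∈ s'∈ (inj₂ (inj₂ e)) = no-complement s∈ s'∈ e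

module _ {n : ℕ} where

  Class-functional : ∀ {s s' p} → Class n s p → Class n s' p → s ≡ s'
  Class-functional {p = x , y} e e' = +-cancelˡ-≡ ∣ toℕ x - toℕ y ∣ _ _ (trans e (sym e'))

  Class-resp-MSetEq₂ : ∀ {s p q} → MSetEq₂ p q → Class n s p → Class n s q
  Class-resp-MSetEq₂ (inj₁ (refl , refl)) e = e
  Class-resp-MSetEq₂ {s} {x , y} (inj₂ (refl , refl)) e = trans (cong (_+ s) (∣-∣-comm (toℕ y) (toℕ x))) e

  Clash-sym : ∀ {s s'} → Clash n s s' → Clash n s' s
  Clash-sym (inj₁ e)        = inj₂ (inj₁ e)
  Clash-sym (inj₂ (inj₁ e)) = inj₁ e
  Clash-sym {s} {s'} (inj₂ (inj₂ e)) = inj₂ (inj₂ (trans (+-comm s' s) e))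

  Class-succ : ∀ {c u v : Fin n} {s s'} → Class n s (c , u) → Class n s' (c , v) →
    toℕ v ≡ suc (toℕ u) → s' ≡ suc s ⊎ s ≡ suc s'
  Class-succ {c} {u} {v} {s} {s'} e e' v≡1+u
    with ∣m-1+n∣≡1+∣m-n∣⊎∣m-n∣≡1+∣m-1+n∣ (toℕ c) (toℕ u)
  ... | inj₁ d' = inj₂ (+-cancelˡ-≡ ∣ toℕ c - toℕ u ∣ _ _ (begin
    ∣ toℕ c - toℕ u ∣ + s           ≡⟨ e ⟩
    n                               ≡⟨ e' ⟨
    ∣ toℕ c - toℕ v ∣ + s'          ≡⟨ cong (λ w → ∣ toℕ c - w ∣ + s') v≡1+u ⟩
    ∣ toℕ c - suc (toℕ u) ∣ + s'    ≡⟨ cong (_+ s') d' ⟩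
    suc ∣ toℕ c - toℕ u ∣ + s'      ≡⟨ +-suc _ s' ⟨
    ∣ toℕ c - toℕ u ∣ + suc s'      ∎))
    where open ≡-Reasoning
  ... | inj₂ d = inj₁ (+-cancelˡ-≡ ∣ toℕ c - toℕ v ∣ _ _ (begin
    ∣ toℕ c - toℕ v ∣ + s'               ≡⟨ e' ⟩
    n                                    ≡⟨ e ⟨
    ∣ toℕ c - toℕ u ∣ + s                ≡⟨ cong (_+ s) (trans d (cong (λ w → suc ∣ toℕ c - w ∣) (sym v≡1+u))) ⟩
    suc ∣ toℕ c - toℕ v ∣ + s            ≡⟨ +-suc _ s ⟨
    ∣ toℕ c - toℕ v ∣ + suc s            ∎))
    where open ≡-Reasoning

  -- The distances from c to n − 1 and to 0 are n − 1 − c and c, so s = 1 + c and s' = n − c.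
  Class-wrap : ∀ {c u v : Fin n} {s s'} → Class n s (c , u) → Class n s' (c , v) →
    suc (toℕ u) ≡ n → toℕ v ≡ 0 → s + s' ≡ suc n
  Class-wrap {c} {u} {v} {s} {s'} e e' 1+u≡n v≡0 = begin
    s + s'                          ≡⟨ cong (_+ s') s≡1+c ⟩
    suc (toℕ c + s')                ≡⟨ cong (λ w → suc (w + s')) (∣-∣-identityʳ (toℕ c)) ⟨
    suc (∣ toℕ c - 0 ∣ + s')        ≡⟨ cong (λ w → suc (∣ toℕ c - w ∣ + s')) v≡0 ⟨
    suc (∣ toℕ c - toℕ v ∣ + s')    ≡⟨ cong suc e' ⟩
    suc n                           ∎
    where
    open ≡-Reasoning
    c≤u : toℕ c ≤ toℕ u
    c≤u = s≤s⁻¹ (subst (toℕ c <_) (sym 1+u≡n) (toℕ<n c))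
    s≡1+c : s ≡ suc (toℕ c)
    s≡1+c = +-cancelˡ-≡ (toℕ u ∸ toℕ c) _ _ (begin
      toℕ u ∸ toℕ c + s               ≡⟨ cong (_+ s) (m≤n⇒∣m-n∣≡n∸m c≤u) ⟨
      ∣ toℕ c - toℕ u ∣ + s           ≡⟨ trans e (sym 1+u≡n) ⟩
      suc (toℕ u)                     ≡⟨ cong suc (m∸n+n≡m c≤u) ⟨
      suc (toℕ u ∸ toℕ c + toℕ c)     ≡⟨ +-suc _ (toℕ c) ⟨
      toℕ u ∸ toℕ c + suc (toℕ c)     ∎)

  Class-step : ∀ {c u v : Fin n} {s s'} → Class n s (c , u) → Class n s' (c , v) →
    CycSucc u v → Clash n s s'
  Class-step {c} e e' (inj₁ v≡1+u)         = Sum.map₂ inj₁ (Class-succ {c} e e' v≡1+u)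
  Class-step {c} e e' (inj₂ (1+u≡n , v≡0)) = inj₂ (inj₂ (Class-wrap {c} e e' 1+u≡n v≡0))

  Class-adjacent : ∀ {s s' p q} → Class n s p → Class n s' q →
    F2Adj (CycleAdj n) p q → Clash n s s'
  Class-adjacent e e' (c , u , v , p≈ , q≈ , _ , inj₁ u→v) =
    Class-step {c} (Class-resp-MSetEq₂ p≈ e) (Class-resp-MSetEq₂ q≈ e') u→v
  Class-adjacent e e' (c , u , v , p≈ , q≈ , _ , inj₂ v→u) =
    Clash-sym (Class-step {c} (Class-resp-MSetEq₂ q≈ e') (Class-resp-MSetEq₂ p≈ e) v→u)

  bandVertex : (s : ℕ) → s ≤ n → Fin s → Fin n × Fin n
  bandVertex s s≤n a =
    fromℕ< (<-≤-trans (toℕ<n a) s≤n) ,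
    fromℕ< (subst (toℕ a + (n ∸ s) <_) (m+[n∸m]≡n s≤n) (+-monoˡ-< (n ∸ s) (toℕ<n a)))

  band : (s : ℕ) → s ≤ n → List (Fin n × Fin n)
  band s s≤n = map (bandVertex s s≤n) (allFin s)

  band-length : ∀ s s≤n → length (band s s≤n) ≡ s
  band-length s s≤n = trans (length-map _ (allFin s)) (length-tabulate _)

  band-member : ∀ s s≤n {x y} → (x , y) ∈ band s s≤n → toℕ y ≡ toℕ x + (n ∸ s)
  band-member s s≤n p∈ with ∈-map⁻ (bandVertex s s≤n) p∈
  ... | a , _ , refl = trans (toℕ-fromℕ< _) (cong (_+ (n ∸ s)) (sym (toℕ-fromℕ< _)))

  band-unique : ∀ s s≤n → Unique (band s s≤n)
  band-unique s s≤n = Unique.map⁺ injective (Unique.allFin⁺ s)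
    where
    injective : ∀ {a b} → bandVertex s s≤n a ≡ bandVertex s s≤n b → a ≡ b
    injective eq = toℕ-injective (trans (sym (toℕ-fromℕ< _))
      (trans (cong (λ p → toℕ (proj₁ p)) eq) (toℕ-fromℕ< _)))

  band-Class : ∀ s s≤n {p} → p ∈ band s s≤n → Class n s p
  band-Class s s≤n {x , y} p∈ = begin
    ∣ toℕ x - toℕ y ∣ + s              ≡⟨ cong (λ w → ∣ toℕ x - w ∣ + s) (band-member s s≤n p∈) ⟩
    ∣ toℕ x - toℕ x + (n ∸ s) ∣ + s    ≡⟨ cong (_+ s) (∣m-m+n∣≡n (toℕ x) (n ∸ s)) ⟩
    n ∸ s + s                          ≡⟨ m∸n+n≡m s≤n ⟩
    n                                  ∎
    where open ≡-Reasoning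

  band-sorted : ∀ s s≤n {p} → p ∈ band s s≤n → F2Vertex n p
  band-sorted s s≤n {x , y} p∈ = subst (toℕ x ≤_) (sym (band-member s s≤n p∈)) (m≤m+n (toℕ x) (n ∸ s))

  bands : (S : List ℕ) → All (_≤ n) S → List (Fin n × Fin n)
  bands []      []          = []
  bands (s ∷ S) (s≤n ∷ S≤n) = band s s≤n ++ bands S S≤n

  bands-length : ∀ S S≤n → length (bands S S≤n) ≡ sum S
  bands-length []      []          = refl
  bands-length (s ∷ S) (s≤n ∷ S≤n) = trans (length-++ (band s s≤n))
    (cong₂ _+_ (band-length s s≤n) (bands-length S S≤n))

  bands-member : ∀ S S≤n {p} → p ∈ bands S S≤n → ∃[ s ] s ∈ S × Class n s p × F2Vertex n p
  bands-member (s ∷ S) (s≤n ∷ S≤n) p∈ with ∈-++⁻ (band s s≤n) p∈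
  ... | inj₁ p∈band = s , here refl , band-Class s s≤n p∈band , band-sorted s s≤n p∈band
  ... | inj₂ p∈bands with bands-member S S≤n p∈bands
  ...   | s' , s'∈ , class , sorted = s' , there s'∈ , class , sorted

  bands-unique : ∀ S S≤n → Unique S → Unique (bands S S≤n)
  bands-unique []      []          []        = []
  bands-unique (s ∷ S) (s≤n ∷ S≤n) (s∉S ∷ u) = Unique.++⁺ (band-unique s s≤n) (bands-unique S S≤n u) disjoint
    where
    disjoint : ∀ {p} → ¬ (p ∈ band s s≤n × p ∈ bands S S≤n)
    disjoint {p} (p∈band , p∈bands) with bands-member S S≤n p∈bands
    ... | s' , s'∈ , class , _ = All.lookup s∉S s'∈ (Class-functional {p = p} (band-Class s s≤n p∈band) class)

  lowerBound : ∀ {S} → Admissible n S → Σ (List (Fin n × Fin n)) λ L → IndepF2 n L × length L ≡ sum S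
  lowerBound {S} adm = bands S bounded , (sorted , bands-unique S bounded unique , independent) , bands-length S bounded
    where
    open Admissible adm
    sorted : All (F2Vertex n) (bands S bounded)
    sorted = All.tabulate λ p∈ → proj₂ (proj₂ (proj₂ (bands-member S bounded p∈)))
    independent : ∀ {p q} → p ∈ bands S bounded → q ∈ bands S bounded → ¬ F2Adj (CycleAdj n) p q
    independent p∈ q∈ adj with bands-member S bounded p∈ | bands-member S bounded q∈
    ... | s , s∈ , class , _ | s' , s'∈ , class' , _ = clash-free s∈ s'∈ (Class-adjacent class class' adj)

progression : ℕ → ℕ → List ℕ
progression a zero    = []
progression a (suc k) = a + 2 * k ∷ progression a k

∈-progression⁻ : ∀ {a k s} → s ∈ progression a k → ∃[ i ] i < k × s ≡ a + 2 * i
∈-progression⁻ {k = suc k} (here refl) = k , n<1+n k , refl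
∈-progression⁻ {k = suc k} (there s∈) with ∈-progression⁻ s∈
... | i , i<k , s≡ = i , m<n⇒m<1+n i<k , s≡

progression-unique : ∀ a k → Unique (progression a k)
progression-unique a zero    = []
progression-unique a (suc k) = All.tabulate head∉ ∷ progression-unique a k
  where
  head∉ : ∀ {s} → s ∈ progression a k → a + 2 * k ≢ s
  head∉ s∈ eq with ∈-progression⁻ s∈
  ... | i , i<k , refl = <⇒≢ i<k (sym (*-cancelˡ-≡ k i 2 (+-cancelˡ-≡ a _ _ eq)))

sum-progression : ∀ a k → sum (progression a k) + k ≡ k * (a + k)
sum-progression a zero    = refl
sum-progression a (suc k) = begin
  a + 2 * k + sum (progression a k) + suc k   ≡⟨ regroup a k (sum (progression a k)) ⟩
  suc (a + 2 * k) + (sum (progression a k) + k) ≡⟨ cong (suc (a + 2 * k) +_) (sum-progression a k) ⟩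
  suc (a + 2 * k) + k * (a + k)               ≡⟨ expand a k ⟩
  suc k * (a + suc k)                         ∎
  where
  open ≡-Reasoning
  regroup : ∀ a k X → a + 2 * k + X + suc k ≡ suc (a + 2 * k) + (X + k)
  regroup = solve-∀
  expand : ∀ a k → suc (a + 2 * k) + k * (a + k) ≡ suc k * (a + suc k)
  expand = solve-∀

even-admissible : ∀ m → Admissible (2 * m) (progression 2 m)
even-admissible m = record
  { unique        = progression-unique 2 m
  ; bounded       = All.tabulate λ s∈ → bounded (∈-progression⁻ s∈)
  ; no-successor  = λ s∈ s'∈ → no-successor (∈-progression⁻ s∈) (∈-progression⁻ s'∈)
  ; no-complement = λ s∈ s'∈ → no-complement (∈-progression⁻ s∈) (∈-progression⁻ s'∈)
  }
  where
  bounded : ∀ {s} → ∃[ i ] i < m × s ≡ 2 + 2 * i → s ≤ 2 * m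
  bounded (i , i<m , refl) = subst (_≤ 2 * m) (*-distribˡ-+ 2 1 i) (*-monoʳ-≤ 2 i<m)
  no-successor : ∀ {s s'} → ∃[ i ] i < m × s ≡ 2 + 2 * i → ∃[ j ] j < m × s' ≡ 2 + 2 * j → s' ≢ suc s
  no-successor (i , _ , refl) (j , _ , refl) eq =
    even≢odd (suc j) (suc i) (trans (*-distribˡ-+ 2 1 j) (trans eq (cong suc (sym (*-distribˡ-+ 2 1 i)))))
  no-complement : ∀ {s s'} → ∃[ i ] i < m × s ≡ 2 + 2 * i → ∃[ j ] j < m × s' ≡ 2 + 2 * j → s + s' ≢ suc (2 * m)
  no-complement (i , _ , refl) (j , _ , refl) eq = even≢odd (suc i + suc j) m (trans (*-distribˡ-+ 2 (suc i) (suc j))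
    (trans (cong₂ _+_ (*-distribˡ-+ 2 1 i) (*-distribˡ-+ 2 1 j)) eq))

module _ {r t : ℕ} (r≤t : r ≤ t) (t≤1+r : t ≤ suc r) where

  private
    Low High : ℕ → Set
    Low  s = ∃[ j ] j < r × s ≡ 2 * suc j
    High s = ∃[ i ] i < t × s ≡ suc (2 * (suc r + i))

    low-shape : ∀ {s} → s ∈ progression 2 r → Low s
    low-shape s∈ with ∈-progression⁻ s∈
    ... | j , j<r , refl = j , j<r , sym (*-distribˡ-+ 2 1 j)

    high-shape : ∀ {s} → s ∈ progression (2 * r + 3) t → High s
    high-shape s∈ with ∈-progression⁻ s∈
    ... | i , i<t , refl = i , i<t , high-form r i
      where
      high-form : ∀ r i → 2 * r + 3 + 2 * i ≡ suc (2 * (suc r + i))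
      high-form = solve-∀

    shape : ∀ {s} → s ∈ progression 2 r ++ progression (2 * r + 3) t → Low s ⊎ High s
    shape s∈ = Sum.map low-shape high-shape (∈-++⁻ (progression 2 r) s∈)

    even+odd : ∀ a b → 2 * a + suc (2 * b) ≡ suc (2 * (a + b))
    even+odd = solve-∀

    1+r+i≤r+t : ∀ {i} → i < t → suc r + i ≤ r + t
    1+r+i≤r+t {i} i<t = subst (_≤ r + t) (+-suc r i) (+-monoʳ-≤ r i<t)

    bounded : ∀ {s} → Low s ⊎ High s → s ≤ suc (2 * (r + t))
    bounded (inj₁ (j , j<r , refl)) = m≤n⇒m≤1+n (*-monoʳ-≤ 2 (≤-trans j<r (m≤m+n r t)))
    bounded (inj₂ (i , i<t , refl)) = s≤s (*-monoʳ-≤ 2 (1+r+i≤r+t i<t))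

    no-successor : ∀ {s s'} → Low s ⊎ High s → Low s' ⊎ High s' → s' ≢ suc s
    no-successor (inj₁ (j , _ , refl)) (inj₁ (k , _ , refl)) eq = even≢odd (suc k) (suc j) eq
    no-successor (inj₂ (i , _ , refl)) (inj₂ (k , _ , refl)) eq =
      even≢odd (suc (suc r + i)) (suc r + k) (trans (*-distribˡ-+ 2 1 (suc r + i)) (sym eq))
    no-successor (inj₁ (j , j<r , refl)) (inj₂ (i , _ , refl)) eq =
      <⇒≱ j<r (subst (r ≤_) (suc-injective (*-cancelˡ-≡ _ _ 2 (suc-injective eq))) (m≤m+n r i))
    no-successor (inj₂ (i , _ , refl)) (inj₁ (j , j<r , refl)) eq =
      <⇒≱ j<r (subst (r ≤_) (sym j≡1+r+i) (m≤n⇒m≤1+n (m≤m+n r i)))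
      where
      j≡1+r+i : j ≡ suc (r + i)
      j≡1+r+i = suc-injective (*-cancelˡ-≡ (suc j) _ 2 (trans eq (sym (*-distribˡ-+ 2 1 (suc r + i)))))

    no-complement : ∀ {s s'} → Low s ⊎ High s → Low s' ⊎ High s' → s + s' ≢ 2 * suc (r + t)
    no-complement (inj₁ (j , j<r , refl)) (inj₁ (k , k<r , refl)) eq =
      <⇒≢ (s≤s (+-mono-≤ j<r (≤-trans k<r r≤t))) (*-cancelˡ-≡ _ _ 2 (trans (*-distribˡ-+ 2 (suc j) (suc k)) eq))
    no-complement (inj₂ (i , _ , refl)) (inj₂ (k , _ , refl)) eq = <⇒≢ r+t<a+b (sym (suc-injective a+b≡))
      where
      a = suc r + i
      b = suc r + k
      odd+odd : ∀ a b → suc (2 * a) + suc (2 * b) ≡ 2 * suc (a + b)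
      odd+odd = solve-∀
      a+b≡ : suc (a + b) ≡ suc (r + t)
      a+b≡ = *-cancelˡ-≡ _ _ 2 (trans (sym (odd+odd a b)) eq)
      r+t<a+b : r + t < a + b
      r+t<a+b = begin-strict
        r + t          ≤⟨ +-monoʳ-≤ r t≤1+r ⟩
        r + suc r      <⟨ +-monoˡ-< (suc r) (n<1+n r) ⟩
        suc r + suc r  ≤⟨ +-mono-≤ (m≤m+n (suc r) i) (m≤m+n (suc r) k) ⟩
        a + b          ∎
        where open ≤-Reasoning
    no-complement (inj₁ (j , _ , refl)) (inj₂ (i , _ , refl)) eq =
      even≢odd (suc (r + t)) (suc j + (suc r + i)) (trans (sym eq) (even+odd (suc j) (suc r + i)))
    no-complement (inj₂ (i , _ , refl)) (inj₁ (j , _ , refl)) eq =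
      even≢odd (suc (r + t)) (suc j + (suc r + i))
        (trans (sym eq) (trans (+-comm _ (2 * suc j)) (even+odd (suc j) (suc r + i))))

  odd-admissible : Admissible (suc (2 * (r + t))) (progression 2 r ++ progression (2 * r + 3) t)
  odd-admissible = record
    { unique        = Unique.++⁺ (progression-unique 2 r) (progression-unique (2 * r + 3) t) disjoint
    ; bounded       = All.tabulate λ s∈ → bounded (shape s∈)
    ; no-successor  = λ s∈ s'∈ → no-successor (shape s∈) (shape s'∈)
    ; no-complement = λ s∈ s'∈ eq → no-complement (shape s∈) (shape s'∈) (trans eq (sym (*-distribˡ-+ 2 1 (r + t))))
    }
    where
    disjoint : ∀ {s} → s ∈ progression 2 r × s ∈ progression (2 * r + 3) t → ⊥
    disjoint (s∈low , s∈high) with low-shape s∈low | high-shape s∈high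
    ... | j , _ , refl | i , _ , eq = even≢odd (suc j) (suc r + i) eq

independenceNumber : ∀ {n h k S} → 2 ≤ n → n ≤ suc (h + h) → n * suc h ≤ suc (k + k) →
  Admissible n S → sum S ≡ k → IndependenceNumberF2C n k
independenceNumber {k = k} 2≤n n≤1+h+h bound admissible refl =
  lowerBound admissible ,
  λ L L-indep → m+m≤1+k+k⇒m≤k k (≤-trans (UpperBound.upperBound 2≤n n≤1+h+h L-indep) bound)

independenceNumber-even : ∀ m → 2 ≤ 2 * m → IndependenceNumberF2C (2 * m) (m * suc m)
independenceNumber-even m 2≤n =
  independenceNumber {h = m} 2≤n (m≤n⇒m≤1+n (≤-reflexive (2*m≡m+m m)))
    (m≤n⇒m≤1+n (≤-reflexive (bound m))) (even-admissible m)
    (+-cancelʳ-≡ m _ _ (trans (sum-progression 2 m) (total m)))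
  where
  bound : ∀ m → 2 * m * suc m ≡ m * suc m + m * suc m
  bound = solve-∀
  total : ∀ m → m * (2 + m) ≡ m * suc m + m
  total = solve-∀

independenceNumber-odd : ∀ r t → r ≤ t → t ≤ suc r → 2 ≤ suc (2 * (r + t)) →
  IndependenceNumberF2C (suc (2 * (r + t))) (r * suc r + t * (2 * r + 2 + t))
independenceNumber-odd r t r≤t t≤1+r 2≤n =
  independenceNumber {h = r + t} 2≤n (≤-reflexive (cong suc (2*m≡m+m (r + t))))
    (+-cancelʳ-≤ r _ _ (≤-trans (+-monoʳ-≤ _ r≤t) (≤-reflexive (bound r t))))
    (odd-admissible r≤t t≤1+r) sum≡
  where
  bound : ∀ r t → suc (2 * (r + t)) * suc (r + t) + t ≡
    suc ((r * suc r + t * (2 * r + 2 + t)) + (r * suc r + t * (2 * r + 2 + t))) + r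
  bound = solve-∀
  sum≡ : sum (progression 2 r ++ progression (2 * r + 3) t) ≡ r * suc r + t * (2 * r + 2 + t)
  sum≡ = +-cancelʳ-≡ (r + t) _ _ (begin
    sum (progression 2 r ++ progression (2 * r + 3) t) + (r + t)
      ≡⟨ cong (_+ (r + t)) (sum-++ (progression 2 r) (progression (2 * r + 3) t)) ⟩
    sum (progression 2 r) + sum (progression (2 * r + 3) t) + (r + t)
      ≡⟨ interchange (sum (progression 2 r)) (sum (progression (2 * r + 3) t)) r t ⟩
    (sum (progression 2 r) + r) + (sum (progression (2 * r + 3) t) + t)
      ≡⟨ cong₂ _+_ (sum-progression 2 r) (sum-progression (2 * r + 3) t) ⟩
    r * (2 + r) + t * (2 * r + 3 + t)
      ≡⟨ total r t ⟩
    r * suc r + t * (2 * r + 2 + t) + (r + t) ∎)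
    where
    open ≡-Reasoning
    interchange : ∀ a b r t → a + b + (r + t) ≡ (a + r) + (b + t)
    interchange = solve-∀
    total : ∀ r t → r * (2 + r) + t * (2 * r + 3 + t) ≡ r * suc r + t * (2 * r + 2 + t) + (r + t)
    total = solve-∀

independenceNumber-4r : ∀ r → 2 ≤ 4 * r → IndependenceNumberF2C (4 * r) (r * (4 * r + 2))
independenceNumber-4r r 2≤n = subst₂ IndependenceNumberF2C (sym (n≡ r)) (k≡ r)
  (independenceNumber-even (r + r) (subst (2 ≤_) (n≡ r) 2≤n))
  where
  n≡ : ∀ r → 4 * r ≡ 2 * (r + r)
  n≡ = solve-∀
  k≡ : ∀ r → (r + r) * suc (r + r) ≡ r * (4 * r + 2)
  k≡ = solve-∀

independenceNumber-4r+1 : ∀ r → 2 ≤ 4 * r + 1 → IndependenceNumberF2C (4 * r + 1) (r * (4 * r + 1 + 2))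
independenceNumber-4r+1 r 2≤n = subst₂ IndependenceNumberF2C (sym (n≡ r)) (k≡ r)
  (independenceNumber-odd r r ≤-refl (n≤1+n r) (subst (2 ≤_) (n≡ r) 2≤n))
  where
  n≡ : ∀ r → 4 * r + 1 ≡ suc (2 * (r + r))
  n≡ = solve-∀
  k≡ : ∀ r → r * suc r + r * (2 * r + 2 + r) ≡ r * (4 * r + 1 + 2)
  k≡ = solve-∀

independenceNumber-4r+2 : ∀ r → IndependenceNumberF2C (4 * r + 2) ((r + 1) * (4 * r + 2))
independenceNumber-4r+2 r = subst₂ IndependenceNumberF2C (sym (n≡ r)) (k≡ r)
  (independenceNumber-even (suc (r + r)) (subst (2 ≤_) (n≡ r) (m≤n+m 2 (4 * r))))
  where
  n≡ : ∀ r → 4 * r + 2 ≡ 2 * suc (r + r)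
  n≡ = solve-∀
  k≡ : ∀ r → suc (r + r) * suc (suc (r + r)) ≡ (r + 1) * (4 * r + 2)
  k≡ = solve-∀

independenceNumber-4r+3 : ∀ r → IndependenceNumberF2C (4 * r + 3) ((r + 1) * (4 * r + 3))
independenceNumber-4r+3 r = subst₂ IndependenceNumberF2C (sym (n≡ r)) (k≡ r)
  (independenceNumber-odd r (suc r) (n≤1+n r) ≤-refl (subst (2 ≤_) (n≡ r) (≤-trans (n≤1+n 2) (m≤n+m 3 (4 * r)))))
  where
  n≡ : ∀ r → 4 * r + 3 ≡ suc (2 * (r + suc r))
  n≡ = solve-∀
  k≡ : ∀ r → r * suc r + suc r * (2 * r + 2 + suc r) ≡ (r + 1) * (4 * r + 3)
  k≡ = solve-∀

mainTheorem5 : ((r : ℕ) → 2 ≤ 4 * r → IndependenceNumberF2C (4 * r) (r * (4 * r + 2)))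
    × ((r : ℕ) → 2 ≤ 4 * r + 1 → IndependenceNumberF2C (4 * r + 1) (r * (4 * r + 1 + 2)))
    × ((r : ℕ) → IndependenceNumberF2C (4 * r + 2) ((r + 1) * (4 * r + 2)))
    × ((r : ℕ) → IndependenceNumberF2C (4 * r + 3) ((r + 1) * (4 * r + 3)))
mainTheorem5 =
  independenceNumber-4r , independenceNumber-4r+1 , independenceNumber-4r+2 , independenceNumber-4r+3
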